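{- Let $\Gamma$ be a set of statements, $P,Q,S\in\mathsf{T}$ and $x\in\mathsf{V}\setminus(\mathsf{F}(\Gamma)\cup\mathsf{F}(Q))$. If $\Gamma\cup\{(x:Q)\}\vDash(S:P)$ then $\Gamma\vDash(\lambda xQS:\pi xQP)$.
   Context: Set-theoretic conventions: for sets $R,s$, $\mathrm{dom}(R)=\{d\mid\exists r\,\langle r,d\rangle\in R\}$, $R(s)=\bigcup\{r\mid\langle r,s\rangle\in R\}$; functions are sets of pairs $\langle F(d),d\rangle$; for a function $F$ with domain $X$, $\prod F$ is the set of functions $f$ on $X$ with $f(x)\in F(x)$. Terms: constants $\mathsf{C}=\{\mathsf{c},\mathsf{c}',\dots\}$, variables $\mathsf{V}=\{\mathsf{v},\mathsf{v}',\dots\}$; $\mathsf{T}$ is the smallest set of strings containing $\mathsf{C}\cup\mathsf{V}$ and $\rho S$, $\beta RS$, $\lambda xRS$ for $R,S\in\mathsf{T}$, $x\in\mathsf{V}$. We write $\pi xQP$ for $\rho\lambda xQP$. Free variables: $\mathsf{F}(a)=\emptyset$ for constants, $\mathsf{F}(x)=\{x\}$, $\mathsf{F}(\rho R)=\mathsf{F}(R)$, $\mathsf{F}(\beta RS)=\mathsf{F}(R)\cup\mathsf{F}(S)$, $\mathsf{F}(\lambda xRS)=\mathsf{F}(R)\cup(\mathsf{F}(S)\setminus\{x\})$. An assignment (function from $\mathsf{C}\cup\mathsf{V}$ to sets) extends uniquely to an interpretation $\llbracket\cdot\rrbracket$ on $\mathsf{T}$ with $\llbracket\rho S\rrbracket=\prod\llbracket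 S\rrbracket$, $\llbracket\beta RS\rrbracket=\llbracket R\rrbracket(\llbracket S\rrbracket)$, $\llbracket\lambda xRS\rrbracket=\{\langle\llbracket S\rrbracket_{\langle r,x\rangle},r\rangle\mid r\in\llbracket R\rrbracket\}$ ($\llbracket\cdot\rrbracket_{\langle s,x\rangle}$ = assignment modified to value $s$ at $x$). Terms related by renaming of bound variables are $\alpha$-equivalent and have equal interpretations and equal free variables. A statement $(S:P)$ is the pair of $\alpha$-equivalence classes of $S$ and $P$; an interpretation satisfies $(S:P)$ iff $\llbracket S\rrbracket\in\llbracket P\rrbracket$. $\Gamma\vDash X$ means every interpretation satisfying all statements of $\Gamma$ satisfies $X$. $\mathsf{F}(\Gamma)=\bigcup_{(S:P)\in\Gamma}(\mathsf{F}(S)\cup\mathsf{F}(P))$. -}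

module Defs where

open import Data.Nat using (ℕ; _≟_)
open import Data.Product using (Σ; _×_; _,_)
open import Data.Sum using (_⊎_; inj₁; inj₂)
open import Data.Bool using (if_then_else_)
open import Relation.Nullary using (¬_; does)
open import Relation.Binary.PropositionalEquality using (_≡_)
open import Induction.WellFounded using (WellFounded)

-- Constants C and variables V: two disjoint countably infinite
-- alphabets with decidable equality, both modelled by ℕ.
Const : Set
Const = ℕ

Var : Set
Var = ℕ

-- Terms T.  The grammar is prefix (Polish) notation, hence uniquely
-- readable; the inductive type is exactly the set of such strings.
data Term : Set where
  con : Const → Term
  var : Var → Term
  ρ   : Term → Term
  β   : Term → Term → Term
  lam : Var → Term → Term → Term

π : Var → Term → Term → Term
π x Q P = ρ (lam x Q P)

data Free (x : Var) : Term → Set where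
  fvar : Free x (var x)
  fρ   : ∀ {R} → Free x R → Free x (ρ R)
  fβˡ  : ∀ {R S} → Free x R → Free x (β R S)
  fβʳ  : ∀ {R S} → Free x S → Free x (β R S)
  flamˡ : ∀ {y R S} → Free x R → Free x (lam y R S)
  flamʳ : ∀ {y R S} → Free x S → ¬ (x ≡ y) → Free x (lam y R S)

Stmt : Set
Stmt = Term × Term

Stmts : Set₁
Stmts = Stmt → Set

_∪｛_｝ : Stmts → Stmt → Stmts
(Γ ∪｛ X ｝) Y = Γ Y ⊎ Y ≡ X

NotFreeIn : Var → Stmts → Set
NotFreeIn x Γ = ∀ S P → Γ (S , P) → ¬ Free x S × ¬ Free x P

-- A universe of sets: a model of (second-order) ZF, with the
-- existence axioms given as operations.

_⇔_ : Set → Set → Set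
A ⇔ B = (A → B) × (B → A)
infix 2 _⇔_

record ZFModel : Set₁ where
  field
    𝕍    : Set
    _∈_  : 𝕍 → 𝕍 → Set
  infix 4 _∈_
  field
    ext  : ∀ a b → (∀ z → z ∈ a ⇔ z ∈ b) → a ≡ b
    ∅    : 𝕍
    ∅-empty : ∀ z → ¬ (z ∈ ∅)
    upair : 𝕍 → 𝕍 → 𝕍
    upair-∈ : ∀ a b z → z ∈ upair a b ⇔ (z ≡ a ⊎ z ≡ b)
    ⋃    : 𝕍 → 𝕍
    ⋃-∈  : ∀ a z → z ∈ ⋃ a ⇔ Σ 𝕍 (λ y → z ∈ y × y ∈ a)
    𝒫    : 𝕍 → 𝕍
    𝒫-∈  : ∀ a z → z ∈ 𝒫 a ⇔ (∀ w → w ∈ z → w ∈ a)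
    sep  : (𝕍 → Set) → 𝕍 → 𝕍
    sep-∈ : ∀ P a z → z ∈ sep P a ⇔ (z ∈ a × P z)
    repl : (𝕍 → 𝕍) → 𝕍 → 𝕍
    repl-∈ : ∀ F a z → z ∈ repl F a ⇔ Σ 𝕍 (λ y → y ∈ a × z ≡ F y)
    ω    : 𝕍
    ω-∅  : ∅ ∈ ω
    ω-suc : ∀ x → x ∈ ω → ⋃ (upair x (upair x x)) ∈ ω
    ∈-wf : WellFounded _∈_

module Semantics (M : ZFModel) where
  open ZFModel M

  ⟨_,_⟩ : 𝕍 → 𝕍 → 𝕍
  ⟨ a , b ⟩ = upair (upair a a) (upair a b)

  dom : 𝕍 → 𝕍
  dom R = sep (λ d → Σ 𝕍 (λ r → ⟨ r , d ⟩ ∈ R)) (⋃ (⋃ R))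

  app : 𝕍 → 𝕍 → 𝕍
  app R s = ⋃ (sep (λ r → ⟨ r , s ⟩ ∈ R) (⋃ (⋃ R)))

  IsFun : 𝕍 → Set
  IsFun f = (∀ z → z ∈ f → Σ 𝕍 (λ r → Σ 𝕍 (λ d → z ≡ ⟨ r , d ⟩)))
          × (∀ r r′ d → ⟨ r , d ⟩ ∈ f → ⟨ r′ , d ⟩ ∈ f → r ≡ r′)

  _⊗_ : 𝕍 → 𝕍 → 𝕍
  A ⊗ B = ⋃ (repl (λ y → repl (λ d → ⟨ y , d ⟩) B) A)

  -- ∏ F = set of functions f with domain dom(F) and f(x) ∈ F(x).
  -- (Every such f is a subset of (⋃⋃⋃F) ⊗ dom F, so this is the full set.)
  ∏ : 𝕍 → 𝕍
  ∏ F = sep (λ f → IsFun f × dom f ≡ dom F × (∀ d → d ∈ dom F → app f d ∈ app F d))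
            (𝒫 (⋃ (⋃ (⋃ F)) ⊗ dom F))

  Assignment : Set
  Assignment = Const ⊎ Var → 𝕍

  _[_↦_] : Assignment → Var → 𝕍 → Assignment
  (a [ x ↦ s ]) (inj₁ c) = a (inj₁ c)
  (a [ x ↦ s ]) (inj₂ y) = if does (y ≟ x) then s else a (inj₂ y)

  ⟦_⟧ : Term → Assignment → 𝕍
  ⟦ con c ⟧ a = a (inj₁ c)
  ⟦ var x ⟧ a = a (inj₂ x)
  ⟦ ρ S ⟧ a = ∏ (⟦ S ⟧ a)
  ⟦ β R S ⟧ a = app (⟦ R ⟧ a) (⟦ S ⟧ a)
  ⟦ lam x R S ⟧ a = repl (λ r → ⟨ ⟦ S ⟧ (a [ x ↦ r ]) , r ⟩) (⟦ R ⟧ a)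

  Sat : Assignment → Stmt → Set
  Sat a (S , P) = ⟦ S ⟧ a ∈ ⟦ P ⟧ a

  _⊨_ : Stmts → Stmt → Set
  Γ ⊨ X = (a : Assignment) → (∀ Y → Γ Y → Sat a Y) → Sat a X

{-# OPTIONS --safe #-}
module Submission where

-- ⟦λxQS⟧ is the graph of r ↦ ⟦S⟧_{⟨r,x⟩} on ⟦Q⟧, and ⟦πxQP⟧ is the product of the
-- graph of r ↦ ⟦P⟧_{⟨r,x⟩} on ⟦Q⟧.  For r ∈ ⟦Q⟧ the modified assignment still
-- satisfies Γ (x is not free there) and also (x : Q) (x is not free in Q), so the
-- hypothesis gives ⟦S⟧_{⟨r,x⟩} ∈ ⟦P⟧_{⟨r,x⟩}; and the graph of a pointwise section
-- of a family over A lies in the product of that family.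

open import Defs
open import Data.Product using (_×_; _,_; proj₁; proj₂)
open import Data.Sum using (_⊎_; inj₁; inj₂)
open import Data.Nat using (_≟_)
open import Data.Bool using (if_then_else_)
open import Relation.Nullary using (¬_; yes; no)
open import Relation.Nullary.Decidable using (dec-true; dec-false)
open import Relation.Binary.PropositionalEquality
  using (_≡_; _≢_; refl; sym; trans; cong; cong₂; subst; subst₂)

module _ (M : ZFModel) where
  open ZFModel M
  open Semantics M

  ∈-upairˡ : ∀ a b → a ∈ upair a b
  ∈-upairˡ a b = proj₂ (upair-∈ a b a) (inj₁ refl)

  ∈-upairʳ : ∀ a b → b ∈ upair a b
  ∈-upairʳ a b = proj₂ (upair-∈ a b b) (inj₂ refl)

  ∈-upair⁻ : ∀ {a b z} → z ∈ upair a b → z ≡ a ⊎ z ≡ b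
  ∈-upair⁻ {a} {b} {z} = proj₁ (upair-∈ a b z)

  ∈-singleton⁻ : ∀ {a z} → z ∈ upair a a → z ≡ a
  ∈-singleton⁻ z∈ with ∈-upair⁻ z∈
  ... | inj₁ z≡a = z≡a
  ... | inj₂ z≡a = z≡a

  ∈-∈-pair⁻ : ∀ {z w a b} → z ∈ w → w ∈ ⟨ a , b ⟩ → z ≡ a ⊎ z ≡ b
  ∈-∈-pair⁻ z∈w w∈ with ∈-upair⁻ w∈
  ... | inj₁ refl = inj₁ (∈-singleton⁻ z∈w)
  ... | inj₂ refl = ∈-upair⁻ z∈w

  ⟨,⟩-injective : ∀ {a b c d} → ⟨ a , b ⟩ ≡ ⟨ c , d ⟩ → a ≡ c × b ≡ d
  ⟨,⟩-injective {a} {b} {c} {d} eq = a≡c , b≡d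
    where
    a≡c : a ≡ c
    a≡c with ∈-upair⁻ (subst (upair a a ∈_) eq (∈-upairˡ _ _))
    ... | inj₁ [a]≡[c] = sym (∈-singleton⁻ (subst (c ∈_) (sym [a]≡[c]) (∈-upairˡ c c)))
    ... | inj₂ [a]≡[c,d] = sym (∈-singleton⁻ (subst (c ∈_) (sym [a]≡[c,d]) (∈-upairˡ c d)))

    -- b ∈ {a,d} and d ∈ {c,b}; if neither gives b = d directly, then b = a = c = d.
    b≡d : b ≡ d
    b≡d with ∈-∈-pair⁻ (∈-upairʳ a b) (subst (upair a b ∈_) eq (∈-upairʳ _ _))
           | ∈-∈-pair⁻ (∈-upairʳ c d) (subst (upair c d ∈_) (sym eq) (∈-upairʳ _ _))
    ... | inj₂ b≡d | _        = b≡d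
    ... | inj₁ b≡a | inj₂ d≡b = sym d≡b
    ... | inj₁ b≡a | inj₁ d≡a = trans b≡a (trans (sym a≡c) (sym d≡a))

  repl-cong : ∀ {F G A B} → (∀ r → F r ≡ G r) → A ≡ B → repl F A ≡ repl G B
  repl-cong {F} {G} {A} F≗G refl = ext _ _ λ z →
    (λ z∈ → let (y , y∈ , z≡) = proj₁ (repl-∈ F A z) z∈
            in proj₂ (repl-∈ G A z) (y , y∈ , trans z≡ (F≗G y))) ,
    (λ z∈ → let (y , y∈ , z≡) = proj₁ (repl-∈ G A z) z∈
            in proj₂ (repl-∈ F A z) (y , y∈ , trans z≡ (sym (F≗G y))))

  ⋃⋃-pairˡ : ∀ {f r d} → ⟨ r , d ⟩ ∈ f → r ∈ ⋃ (⋃ f)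
  ⋃⋃-pairˡ {f} {r} {d} m = proj₂ (⋃-∈ (⋃ f) r)
    (upair r r , ∈-upairˡ r r , proj₂ (⋃-∈ f (upair r r)) (⟨ r , d ⟩ , ∈-upairˡ _ _ , m))

  ⋃⋃-pairʳ : ∀ {f r d} → ⟨ r , d ⟩ ∈ f → d ∈ ⋃ (⋃ f)
  ⋃⋃-pairʳ {f} {r} {d} m = proj₂ (⋃-∈ (⋃ f) d)
    (upair r d , ∈-upairʳ r d , proj₂ (⋃-∈ f (upair r d)) (⟨ r , d ⟩ , ∈-upairʳ _ _ , m))

  ∈-dom : ∀ {f r d} → ⟨ r , d ⟩ ∈ f → d ∈ dom f
  ∈-dom {r = r} m = proj₂ (sep-∈ _ _ _) (⋃⋃-pairʳ m , r , m)

  app-pair : ∀ {f r d} → IsFun f → ⟨ r , d ⟩ ∈ f → app f d ≡ r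
  app-pair {r = r} {d} (_ , single-valued) m = ext _ _ λ z →
    (λ z∈ → let (y , z∈y , y∈) = proj₁ (⋃-∈ _ z) z∈
                (_ , m′) = proj₁ (sep-∈ _ _ y) y∈
            in subst (z ∈_) (single-valued y r d m′ m) z∈y) ,
    (λ z∈ → proj₂ (⋃-∈ _ z) (r , z∈ , proj₂ (sep-∈ _ _ r) (⋃⋃-pairˡ m , m)))

  ∈-⊗ : ∀ {A B y d} → y ∈ A → d ∈ B → ⟨ y , d ⟩ ∈ A ⊗ B
  ∈-⊗ {B = B} {y} {d} y∈ d∈ = proj₂ (⋃-∈ _ _)
    ( repl (λ d′ → ⟨ y , d′ ⟩) B
    , proj₂ (repl-∈ _ _ _) (d , d∈ , refl)
    , proj₂ (repl-∈ _ _ _) (y , y∈ , refl))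

  graph : (𝕍 → 𝕍) → 𝕍 → 𝕍
  graph G A = repl (λ r → ⟨ G r , r ⟩) A

  ∈-graph : ∀ {G A y} → y ∈ A → ⟨ G y , y ⟩ ∈ graph G A
  ∈-graph {A = A} {y} y∈ = proj₂ (repl-∈ _ A _) (y , y∈ , refl)

  ∈-graph⁻ : ∀ {G A r d} → ⟨ r , d ⟩ ∈ graph G A → d ∈ A × r ≡ G d
  ∈-graph⁻ {A = A} m with proj₁ (repl-∈ _ A _) m
  ... | y , y∈ , eq with ⟨,⟩-injective eq
  ...   | r≡Gy , refl = y∈ , r≡Gy

  graph-isFun : ∀ {G A} → IsFun (graph G A)
  graph-isFun {G} {A} =
    (λ z z∈ → let (y , _ , z≡) = proj₁ (repl-∈ _ A z) z∈ in G y , y , z≡) ,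
    (λ r r′ d m m′ → trans (proj₂ (∈-graph⁻ m)) (sym (proj₂ (∈-graph⁻ m′))))

  dom-graph : ∀ {G A} → dom (graph G A) ≡ A
  dom-graph = ext _ _ λ z →
    (λ z∈ → let (_ , _ , m) = proj₁ (sep-∈ _ _ z) z∈ in proj₁ (∈-graph⁻ m)) ,
    (λ z∈ → ∈-dom (∈-graph z∈))

  app-graph : ∀ {G A d} → d ∈ A → app (graph G A) d ≡ G d
  app-graph d∈ = app-pair graph-isFun (∈-graph d∈)

  graph∈∏graph : ∀ {G H A} → (∀ {r} → r ∈ A → G r ∈ H r) → graph G A ∈ ∏ (graph H A)
  graph∈∏graph {G} {H} {A} G∈H = proj₂ (sep-∈ _ _ _)
    (graph⊆ , graph-isFun , trans dom-graph (sym dom-graph) , app∈app)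
    where
    graph⊆ : graph G A ∈ 𝒫 (⋃ (⋃ (⋃ (graph H A))) ⊗ dom (graph H A))
    graph⊆ = proj₂ (𝒫-∈ _ _) λ w w∈ →
      let (y , y∈ , w≡) = proj₁ (repl-∈ _ A w) w∈
          Gy∈⋃⋃⋃ = proj₂ (⋃-∈ _ (G y)) (H y , G∈H y∈ , ⋃⋃-pairˡ (∈-graph y∈))
      in subst (_∈ _) (sym w≡) (∈-⊗ Gy∈⋃⋃⋃ (∈-dom (∈-graph y∈)))

    app∈app : ∀ d → d ∈ dom (graph H A) → app (graph G A) d ∈ app (graph H A) d
    app∈app d d∈dom =
      let d∈ = subst (d ∈_) dom-graph d∈dom
      in subst₂ _∈_ (sym (app-graph d∈)) (sym (app-graph d∈)) (G∈H d∈)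

  [↦]-same : ∀ (a : Assignment) x s → (a [ x ↦ s ]) (inj₂ x) ≡ s
  [↦]-same a x s = cong (λ b → if b then s else a (inj₂ x)) (dec-true (x ≟ x) refl)

  [↦]-other : ∀ (a : Assignment) {x y} s → y ≢ x → (a [ x ↦ s ]) (inj₂ y) ≡ a (inj₂ y)
  [↦]-other a {x} {y} s y≢x = cong (λ b → if b then s else a (inj₂ y)) (dec-false (y ≟ x) y≢x)

  ⟦⟧-coincidence : ∀ T (a b : Assignment) → (∀ c → a (inj₁ c) ≡ b (inj₁ c)) →
                   (∀ y → Free y T → a (inj₂ y) ≡ b (inj₂ y)) → ⟦ T ⟧ a ≡ ⟦ T ⟧ b
  ⟦⟧-coincidence (con c) a b a≗b _ = a≗b c
  ⟦⟧-coincidence (var y) a b _ a≗b = a≗b y fvar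
  ⟦⟧-coincidence (ρ T) a b c≗ v≗ = cong ∏ (⟦⟧-coincidence T a b c≗ λ y f → v≗ y (fρ f))
  ⟦⟧-coincidence (β R S) a b c≗ v≗ =
    cong₂ app (⟦⟧-coincidence R a b c≗ λ y f → v≗ y (fβˡ f))
              (⟦⟧-coincidence S a b c≗ λ y f → v≗ y (fβʳ f))
  ⟦⟧-coincidence (lam y R S) a b c≗ v≗ =
    repl-cong (λ r → cong (⟨_, r ⟩) (⟦⟧-coincidence S (a [ y ↦ r ]) (b [ y ↦ r ]) c≗ (agree r)))
              (⟦⟧-coincidence R a b c≗ λ z f → v≗ z (flamˡ f))
    where
    agree : ∀ r z → Free z S → (a [ y ↦ r ]) (inj₂ z) ≡ (b [ y ↦ r ]) (inj₂ z)
    agree r z f with z ≟ y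
    ... | yes refl = trans ([↦]-same a z r) (sym ([↦]-same b z r))
    ... | no z≢y = trans ([↦]-other a r z≢y) (trans (v≗ z (flamʳ f z≢y)) (sym ([↦]-other b r z≢y)))

  ⟦⟧-[↦]-notFree : ∀ T (a : Assignment) {x} s → ¬ Free x T → ⟦ T ⟧ (a [ x ↦ s ]) ≡ ⟦ T ⟧ a
  ⟦⟧-[↦]-notFree T a s x∉T = ⟦⟧-coincidence T _ a (λ _ → refl)
    λ y y∈T → [↦]-other a s λ { refl → x∉T y∈T }

  [↦]-satisfies-∪ : ∀ {Γ Q x r} (a : Assignment) → NotFreeIn x Γ → ¬ Free x Q →
                    (∀ Y → Γ Y → Sat a Y) → r ∈ ⟦ Q ⟧ a →
                    ∀ Y → (Γ ∪｛ (var x , Q) ｝) Y → Sat (a [ x ↦ r ]) Y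
  [↦]-satisfies-∪ {r = r} a x∉Γ _ a⊨Γ _ (S , P) (inj₁ SP∈Γ) =
    let (x∉S , x∉P) = x∉Γ S P SP∈Γ
    in subst₂ _∈_ (sym (⟦⟧-[↦]-notFree S a r x∉S)) (sym (⟦⟧-[↦]-notFree P a r x∉P)) (a⊨Γ _ SP∈Γ)
  [↦]-satisfies-∪ {Q = Q} {x} {r} a _ x∉Q _ r∈Q _ (inj₂ refl) =
    subst₂ _∈_ (sym ([↦]-same a x r)) (sym (⟦⟧-[↦]-notFree Q a r x∉Q)) r∈Q

proposition7p6 : (M : ZFModel) → let open Semantics M in
    (Γ : Stmts) (P Q S : Term) (x : Var) →
    NotFreeIn x Γ → ¬ Free x Q →
    (Γ ∪｛ (var x , Q) ｝) ⊨ (S , P) →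
    Γ ⊨ (lam x Q S , π x Q P)
proposition7p6 M Γ P Q S x x∉Γ x∉Q Γ,x:Q⊨S:P a a⊨Γ =
  graph∈∏graph M λ r∈Q → Γ,x:Q⊨S:P (a [ x ↦ _ ]) ([↦]-satisfies-∪ M a x∉Γ x∉Q a⊨Γ r∈Q)
  where open Semantics M
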